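{- Let $t$ and $k$ be integers with $1\leqslant k\leqslant \frac{2t+1}{3}$. Then $$\sum_{j=0}^{k-1}\binom{2t+1-3k}{t-1-3j}\binom{2k}{1+2j}\leqslant 2\binom{2t-2}{t-1}.$$
   Context: Binomial coefficients follow the convention $\binom{p}{q}=0$ whenever $q<0$ or $q>p$ (with $p\geqslant 0$), and $\binom{0}{0}=1$. -}

module Defs where

open import Data.Nat using (ℕ; zero; suc; _+_; _*_; _∸_)
open import Data.Nat.Combinatorics using (_C_)
open import Data.Integer using (ℤ; +_; -[1+_]) renaming (_-_ to _-ℤ_)

-- binomial coefficient with integer lower index: p choose q, = 0 when q < 0
-- (and = 0 when q > p, by the stdlib definition of _C_)
binomℤ : ℕ → ℤ → ℕ
binomℤ p (+ q)     = p C q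
binomℤ p -[1+ _ ]  = 0

sumTo : ℕ → (ℕ → ℕ) → ℕ
sumTo zero    f = 0
sumTo (suc n) f = sumTo n f + f n

-- the summand  C(2t+1-3k, t-1-3j) * C(2k, 1+2j)
-- (2t+1-3k ≥ 0 under the hypothesis 3k ≤ 2t+1, so natural subtraction is exact)
summand : ℕ → ℕ → ℕ → ℕ
summand t k j = binomℤ (2 * t + 1 ∸ 3 * k) ((+ t -ℤ + 1) -ℤ + (3 * j))
              * ((2 * k) C (1 + 2 * j))

module Submission where

-- Each binomial C(2t+1-3k, ·) is at most the central coefficient c(n) of its row n = 2t+1-3k,
-- and the odd-indexed entries of row 2k sum to 2^(2k-1), so the sum is at most 2·4^(k-1)·c(n).
-- Three more rows multiply the central coefficient by at least 4 (c(n+3) ≥ 4c(n) for n ≥ 1,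
-- via c(2M+3) ≥ 3c(2M+1) and c(2M+2) = 2c(2M+1)), and n + 3(k-1) = 2t-2.

open import Data.Nat.Base using (ℕ; zero; suc; _+_; _*_; _∸_; _^_; _≤_; z≤n; s≤s; s≤s⁻¹; ⌊_/2⌋; ⌈_/2⌉)
open import Data.Nat.Combinatorics using (_C_; nCk+nC[k+1]≡[n+1]C[k+1]; nCk≡nC[n∸k]; nC1≡n)
open import Data.Nat.Combinatorics.Specification using (k>n⇒nCk≡0)
open import Data.Nat.Properties
open import Data.Nat.Tactic.RingSolver using (solve-∀)
open import Data.Integer.Base using (-[1+_]) renaming (+_ to pos; _-_ to _-ℤ_)
open import Data.Sum.Base using (inj₁; inj₂)
open import Relation.Nullary using (yes; no; contradiction)
open import Relation.Binary.PropositionalEquality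

open import Defs

2*[1+k]≡2+2*k : ∀ k → 2 * suc k ≡ suc (suc (2 * k))
2*[1+k]≡2+2*k = solve-∀

sumTo-cong : ∀ n {f g : ℕ → ℕ} → (∀ j → f j ≡ g j) → sumTo n f ≡ sumTo n g
sumTo-cong zero    f≗g = refl
sumTo-cong (suc n) f≗g = cong₂ _+_ (sumTo-cong n f≗g) (f≗g n)

sumTo-*-≤ : ∀ n c {f w : ℕ → ℕ} → (∀ j → f j ≤ c * w j) → sumTo n f ≤ c * sumTo n w
sumTo-*-≤ zero    c f≤cw = z≤n
sumTo-*-≤ (suc n) c {f} {w} f≤cw = begin
  sumTo n f + f n               ≤⟨ +-mono-≤ (sumTo-*-≤ n c f≤cw) (f≤cw n) ⟩
  c * sumTo n w + c * w n       ≡⟨ *-distribˡ-+ c (sumTo n w) (w n) ⟨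
  c * (sumTo n w + w n)         ∎
  where open ≤-Reasoning

sumTo-pairs : ∀ k f → sumTo k (λ j → f (2 * j) + f (suc (2 * j))) ≡ sumTo (2 * k) f
sumTo-pairs zero    f = refl
sumTo-pairs (suc k) f = begin
  sumTo k (λ j → f (2 * j) + f (suc (2 * j))) + (f (2 * k) + f (suc (2 * k)))
    ≡⟨ cong (_+ (f (2 * k) + f (suc (2 * k)))) (sumTo-pairs k f) ⟩
  sumTo (2 * k) f + (f (2 * k) + f (suc (2 * k)))
    ≡⟨ +-assoc (sumTo (2 * k) f) _ _ ⟨
  sumTo (suc (suc (2 * k))) f
    ≡⟨ cong (λ m → sumTo m f) (2*[1+k]≡2+2*k k) ⟨
  sumTo (2 * suc k) f ∎
  where open ≡-Reasoning

[n+1]C[k+1]≡nCk+nC[k+1] : ∀ n k → suc n C suc k ≡ n C k + n C suc k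
[n+1]C[k+1]≡nCk+nC[k+1] n k = sym (nCk+nC[k+1]≡[n+1]C[k+1] n k)

nCk≤[n+1]Ck : ∀ n k → n C k ≤ suc n C k
nCk≤[n+1]Ck n zero    = ≤-refl
nCk≤[n+1]Ck n (suc k) = subst (n C suc k ≤_) (sym ([n+1]C[k+1]≡nCk+nC[k+1] n k))
                          (m≤n+m (n C suc k) (n C k))

sumTo-pascal : ∀ n m →
  sumTo (suc m) (suc n C_) ≡ sumTo (suc m) (n C_) + sumTo m (n C_)
sumTo-pascal n zero    = refl
sumTo-pascal n (suc m) = begin
  sumTo (suc m) (suc n C_) + suc n C suc m
    ≡⟨ cong₂ _+_ (sumTo-pascal n m) ([n+1]C[k+1]≡nCk+nC[k+1] n m) ⟩
  (sumTo (suc m) (n C_) + sumTo m (n C_)) + (n C m + n C suc m)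
    ≡⟨ interchange (sumTo (suc m) (n C_)) (sumTo m (n C_)) (n C m) (n C suc m) ⟩
  (sumTo (suc m) (n C_) + n C suc m) + (sumTo m (n C_) + n C m) ∎
  where
  open ≡-Reasoning
  interchange : ∀ a b c d → (a + b) + (c + d) ≡ (a + d) + (b + c)
  interchange = solve-∀

sumTo-nC≡2^n : ∀ n → sumTo (suc n) (n C_) ≡ 2 ^ n
sumTo-nC≡2^n zero    = refl
sumTo-nC≡2^n (suc n) = begin
  sumTo (suc (suc n)) (suc n C_)
    ≡⟨ sumTo-pascal n (suc n) ⟩
  (sumTo (suc n) (n C_) + n C suc n) + sumTo (suc n) (n C_)
    ≡⟨ cong₂ (λ a b → (a + b) + a) (sumTo-nC≡2^n n) (k>n⇒nCk≡0 (n<1+n n)) ⟩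
  (2 ^ n + 0) + 2 ^ n
    ≡⟨ +-comm (2 ^ n + 0) (2 ^ n) ⟩
  2 * 2 ^ n ∎
  where open ≡-Reasoning

sumTo-[2+2k]C[1+2j]≡2*4^k : ∀ k → sumTo (suc k) (λ j → (2 * suc k) C (1 + 2 * j)) ≡ 2 * 4 ^ k
sumTo-[2+2k]C[1+2j]≡2*4^k k = begin
  sumTo (suc k) (λ j → (2 * suc k) C (1 + 2 * j))
    ≡⟨ sumTo-cong (suc k) (λ j → trans (cong (_C (1 + 2 * j)) (2*[1+k]≡2+2*k k))
                                         ([n+1]C[k+1]≡nCk+nC[k+1] n (2 * j))) ⟩
  sumTo (suc k) (λ j → n C (2 * j) + n C suc (2 * j))
    ≡⟨ sumTo-pairs (suc k) (n C_) ⟩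
  sumTo (2 * suc k) (n C_)
    ≡⟨ cong (λ m → sumTo m (n C_)) (2*[1+k]≡2+2*k k) ⟩
  sumTo (suc n) (n C_)
    ≡⟨ sumTo-nC≡2^n n ⟩
  2 * 2 ^ (2 * k)
    ≡⟨ cong (2 *_) (^-*-assoc 2 2 k) ⟨
  2 * 4 ^ k ∎
  where
  open ≡-Reasoning
  n = suc (2 * k)

1+k+k≤[1+k]+[1+k] : ∀ k → suc (k + k) ≤ suc k + suc k
1+k+k≤[1+k]+[1+k] k = s≤s (+-monoʳ-≤ k (n≤1+n k))

[2+2k]Ck≡[2+2k]C[2+k] : ∀ k → (suc k + suc k) C k ≡ (suc k + suc k) C suc (suc k)
[2+2k]Ck≡[2+2k]C[2+k] k = begin
  n C k                         ≡⟨ nCk≡nC[n∸k] (≤-trans (m≤m+n k (suc (suc k))) (≤-reflexive n≡)) ⟩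
  n C (n ∸ k)                   ≡⟨ cong (λ m → n C (m ∸ k)) n≡ ⟨
  n C (k + suc (suc k) ∸ k)     ≡⟨ cong (n C_) (m+n∸m≡n k (suc (suc k))) ⟩
  n C suc (suc k)               ∎
  where
  open ≡-Reasoning
  n = suc k + suc k
  n≡ : k + suc (suc k) ≡ n
  n≡ = +-suc k (suc k)

nCk≤nC[k+1] : ∀ n k → suc (k + k) ≤ n → n C k ≤ n C suc k
nCk≤nC[k+1] zero    k       ()
nCk≤nC[k+1] (suc n) zero    _ = subst (1 ≤_) (sym (nC1≡n (suc n))) (s≤s z≤n)
nCk≤nC[k+1] (suc n) (suc k) 3+2k≤1+n = begin
  suc n C suc k                ≡⟨ [n+1]C[k+1]≡nCk+nC[k+1] n k ⟩
  n C k + n C suc k            ≤⟨ +-monoˡ-≤ (n C suc k) nCk≤nC[k+2] ⟩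
  n C suc (suc k) + n C suc k  ≡⟨ +-comm (n C suc (suc k)) (n C suc k) ⟩
  n C suc k + n C suc (suc k)  ≡⟨ [n+1]C[k+1]≡nCk+nC[k+1] n (suc k) ⟨
  suc n C suc (suc k)          ∎
  where
  open ≤-Reasoning
  2+2k≤n : suc k + suc k ≤ n
  2+2k≤n = s≤s⁻¹ 3+2k≤1+n
  nCk≤nC[k+2] : n C k ≤ n C suc (suc k)
  nCk≤nC[k+2] with m≤n⇒m<n∨m≡n 2+2k≤n
  ... | inj₁ 3+2k≤n = ≤-trans (nCk≤nC[k+1] n k (≤-trans (1+k+k≤[1+k]+[1+k] k) 2+2k≤n))
                              (nCk≤nC[k+1] n (suc k) 3+2k≤n)
  ... | inj₂ refl   = ≤-reflexive ([2+2k]Ck≡[2+2k]C[2+k] k)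

nCj≤nCk : ∀ n {j} k → j ≤ k → k + k ≤ n → n C j ≤ n C k
nCj≤nCk n zero    z≤n   _ = ≤-refl
nCj≤nCk n (suc k) j≤1+k 2+2k≤n with m≤n⇒m<n∨m≡n j≤1+k
... | inj₂ refl  = ≤-refl
... | inj₁ j<1+k = ≤-trans (nCj≤nCk n k (s≤s⁻¹ j<1+k) (≤-trans (n≤1+n (k + k)) 1+2k≤n))
                           (nCk≤nC[k+1] n k 1+2k≤n)
  where
  1+2k≤n : suc (k + k) ≤ n
  1+2k≤n = ≤-trans (1+k+k≤[1+k]+[1+k] k) 2+2k≤n

central : ℕ → ℕ
central n = n C ⌊ n /2⌋

⌊n/2⌋+⌊n/2⌋≤n : ∀ n → ⌊ n /2⌋ + ⌊ n /2⌋ ≤ n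
⌊n/2⌋+⌊n/2⌋≤n n =
  ≤-trans (+-monoʳ-≤ ⌊ n /2⌋ (⌊n/2⌋≤⌈n/2⌉ n)) (≤-reflexive (⌊n/2⌋+⌈n/2⌉≡n n))

⌈n/2⌉≤1+⌊n/2⌋ : ∀ n → ⌈ n /2⌉ ≤ suc ⌊ n /2⌋
⌈n/2⌉≤1+⌊n/2⌋ zero          = z≤n
⌈n/2⌉≤1+⌊n/2⌋ (suc zero)    = ≤-refl
⌈n/2⌉≤1+⌊n/2⌋ (suc (suc n)) = s≤s (⌈n/2⌉≤1+⌊n/2⌋ n)

nCk≤central : ∀ n k → n C k ≤ central n
nCk≤central n k with k ≤? ⌊ n /2⌋ | k ≤? n
... | yes k≤h | _       = nCj≤nCk n ⌊ n /2⌋ k≤h (⌊n/2⌋+⌊n/2⌋≤n n)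
... | no  k≰h | yes k≤n = subst (_≤ central n) (sym (nCk≡nC[n∸k] k≤n))
                            (nCj≤nCk n ⌊ n /2⌋ (m≤n+o⇒m∸n≤o n k n≤k+h) (⌊n/2⌋+⌊n/2⌋≤n n))
  where
  open ≤-Reasoning
  n≤k+h : n ≤ k + ⌊ n /2⌋
  n≤k+h = begin
    n                     ≡⟨ ⌊n/2⌋+⌈n/2⌉≡n n ⟨
    ⌊ n /2⌋ + ⌈ n /2⌉     ≤⟨ +-monoʳ-≤ ⌊ n /2⌋ (≤-trans (⌈n/2⌉≤1+⌊n/2⌋ n) (≰⇒> k≰h)) ⟩
    ⌊ n /2⌋ + k           ≡⟨ +-comm ⌊ n /2⌋ k ⟩
    k + ⌊ n /2⌋           ∎
... | no  _   | no k≰n  = subst (_≤ central n) (sym (k>n⇒nCk≡0 (≰⇒> k≰n))) z≤n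

binomℤ≤central : ∀ p q → binomℤ p q ≤ central p
binomℤ≤central p (pos q)  = nCk≤central p q
binomℤ≤central p -[1+ _ ] = z≤n

central[2n]≡[2n]Cn : ∀ n → central (2 * n) ≡ (2 * n) C n
central[2n]≡[2n]Cn n = cong ((2 * n) C_) (⌊2n/2⌋≡n)
  where
  ⌊2n/2⌋≡n : ⌊ 2 * n /2⌋ ≡ n
  ⌊2n/2⌋≡n = trans (cong (λ m → ⌊ n + m /2⌋) (+-identityʳ n)) (sym (n≡⌊n+n/2⌋ n))

central[1+2m]≡[1+2m]Cm : ∀ m → central (suc (m + m)) ≡ suc (m + m) C m
central[1+2m]≡[1+2m]Cm m = cong (suc (m + m) C_) (sym (n≡⌈n+n/2⌉ m))

central[2+2m]≡2*central[1+2m] : ∀ m → central (suc m + suc m) ≡ 2 * central (suc (m + m))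
central[2+2m]≡2*central[1+2m] m = begin
  central (suc m + suc m)                 ≡⟨ cong ((suc m + suc m) C_) (n≡⌊n+n/2⌋ (suc m)) ⟨
  (suc m + suc m) C suc m                 ≡⟨ cong (λ n → suc n C suc m) (+-suc m m) ⟩
  suc (suc (m + m)) C suc m               ≡⟨ [n+1]C[k+1]≡nCk+nC[k+1] (suc (m + m)) m ⟩
  suc (m + m) C m + suc (m + m) C suc m   ≡⟨ cong (λ c → suc (m + m) C m + c) [1+2m]C[1+m]≡[1+2m]Cm ⟩
  suc (m + m) C m + suc (m + m) C m       ≡⟨ cong (λ c → c + c) (central[1+2m]≡[1+2m]Cm m) ⟨
  c + c                                   ≡⟨ cong (c +_) (+-identityʳ c) ⟨
  2 * c                                   ∎
  where
  open ≡-Reasoning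
  c = central (suc (m + m))
  [1+2m]C[1+m]≡[1+2m]Cm : suc (m + m) C suc m ≡ suc (m + m) C m
  [1+2m]C[1+m]≡[1+2m]Cm = trans (nCk≡nC[n∸k] (s≤s (m≤m+n m m)))
                                (cong (suc (m + m) C_) (m+n∸m≡n m m))

3*central[1+2m]≤central[3+2m] : ∀ m → 3 * central (suc (m + m)) ≤ central (suc (suc m + suc m))
3*central[1+2m]≤central[3+2m] m = begin
  3 * central (suc (m + m))                      ≡⟨ cong (3 *_) (central[1+2m]≡[1+2m]Cm m) ⟩
  c + 2 * c                                      ≤⟨ +-mono-≤ c≤[2+2m]Cm (≤-reflexive 2c≡[2+2m]C[1+m]) ⟩
  (suc m + suc m) C m + (suc m + suc m) C suc m  ≡⟨ [n+1]C[k+1]≡nCk+nC[k+1] (suc m + suc m) m ⟨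
  suc (suc m + suc m) C suc m                    ≡⟨ central[1+2m]≡[1+2m]Cm (suc m) ⟨
  central (suc (suc m + suc m))                  ∎
  where
  open ≤-Reasoning
  c = suc (m + m) C m
  c≤[2+2m]Cm : c ≤ (suc m + suc m) C m
  c≤[2+2m]Cm = subst (λ n → c ≤ n C m) (cong suc (sym (+-suc m m))) (nCk≤[n+1]Ck (suc (m + m)) m)
  2c≡[2+2m]C[1+m] : 2 * c ≡ (suc m + suc m) C suc m
  2c≡[2+2m]C[1+m] = begin-equality
    2 * c                        ≡⟨ cong (2 *_) (central[1+2m]≡[1+2m]Cm m) ⟨
    2 * central (suc (m + m))    ≡⟨ central[2+2m]≡2*central[1+2m] m ⟨
    central (suc m + suc m)      ≡⟨ cong ((suc m + suc m) C_) (n≡⌊n+n/2⌋ (suc m)) ⟨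
    (suc m + suc m) C suc m      ∎

data Parity : ℕ → Set where
  even : ∀ m → Parity (m + m)
  odd  : ∀ m → Parity (suc (m + m))

parity : ∀ n → Parity n
parity zero = even zero
parity (suc n) with parity n
... | even m = odd m
... | odd  m = subst Parity (cong suc (+-suc m m)) (even (suc m))

4*central[n]≤central[3+n] : ∀ n → 1 ≤ n → 4 * central n ≤ central (3 + n)
4*central[n]≤central[3+n] n 1≤n with parity n
... | even zero    = contradiction 1≤n λ ()
... | even (suc m) = begin
  4 * central (suc m + suc m)                 ≡⟨ cong (4 *_) (central[2+2m]≡2*central[1+2m] m) ⟩
  4 * (2 * c)                                 ≡⟨ *-assoc 4 2 c ⟨
  8 * c                                       ≤⟨ *-monoˡ-≤ c (n≤1+n 8) ⟩
  9 * c                                       ≡⟨ *-assoc 3 3 c ⟩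
  3 * (3 * c)                                 ≤⟨ *-monoʳ-≤ 3 (3*central[1+2m]≤central[3+2m] m) ⟩
  3 * central (suc (suc m + suc m))           ≤⟨ 3*central[1+2m]≤central[3+2m] (suc m) ⟩
  central (suc (suc (suc m) + suc (suc m)))   ≡⟨ cong (λ x → central (suc (suc x))) (+-suc (suc m) (suc m)) ⟩
  central (3 + (suc m + suc m))               ∎
  where
  open ≤-Reasoning
  c = central (suc (m + m))
... | odd m = begin
  4 * c                                       ≤⟨ *-monoˡ-≤ c (m≤m+n 4 2) ⟩
  6 * c                                       ≡⟨ *-assoc 2 3 c ⟩
  2 * (3 * c)                                 ≤⟨ *-monoʳ-≤ 2 (3*central[1+2m]≤central[3+2m] m) ⟩
  2 * central (suc (suc m + suc m))           ≡⟨ central[2+2m]≡2*central[1+2m] (suc m) ⟨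
  central (suc (suc m) + suc (suc m))
    ≡⟨ cong (λ x → central (suc (suc x))) (trans (+-suc m (suc m)) (cong suc (+-suc m m))) ⟩
  central (3 + suc (m + m))                   ∎
  where
  open ≤-Reasoning
  c = central (suc (m + m))

4^m*central[n]≤central[n+3m] : ∀ m n → 1 ≤ n → 4 ^ m * central n ≤ central (n + 3 * m)
4^m*central[n]≤central[n+3m] zero    n _   =
  ≤-reflexive (trans (+-identityʳ (central n)) (cong central (sym (+-identityʳ n))))
4^m*central[n]≤central[n+3m] (suc m) n 1≤n = begin
  4 ^ suc m * central n         ≡⟨ *-assoc 4 (4 ^ m) (central n) ⟩
  4 * (4 ^ m * central n)       ≤⟨ *-monoʳ-≤ 4 (4^m*central[n]≤central[n+3m] m n 1≤n) ⟩
  4 * central (n + 3 * m)       ≤⟨ 4*central[n]≤central[3+n] (n + 3 * m) (≤-trans 1≤n (m≤m+n n (3 * m))) ⟩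
  central (3 + (n + 3 * m))     ≡⟨ cong central (3+[n+3m]≡n+3[1+m] n m) ⟩
  central (n + 3 * suc m)       ∎
  where
  open ≤-Reasoning
  3+[n+3m]≡n+3[1+m] : ∀ n m → 3 + (n + 3 * m) ≡ n + 3 * suc m
  3+[n+3m]≡n+3[1+m] = solve-∀

-- Only n = 0, m = 1 fails (central 3 = 3 < 4); for n = 0, m ≥ 2 start from central 6 = 20 ≥ 4 ^ 2.
4^m*central[n]≤central[n+3m]′ : ∀ m n → n + 3 * m ≢ 3 → 4 ^ m * central n ≤ central (n + 3 * m)
4^m*central[n]≤central[n+3m]′ m             (suc n) _  = 4^m*central[n]≤central[n+3m] m (suc n) (s≤s z≤n)
4^m*central[n]≤central[n+3m]′ zero          zero    _  = ≤-refl
4^m*central[n]≤central[n+3m]′ (suc zero)    zero    ≢3 = contradiction refl ≢3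
4^m*central[n]≤central[n+3m]′ (suc (suc m)) zero    _  = begin
  4 ^ suc (suc m) * 1    ≡⟨ trans (*-identityʳ _) (trans (sym (*-assoc 4 4 (4 ^ m))) (*-comm 16 (4 ^ m))) ⟩
  4 ^ m * 16             ≤⟨ *-monoʳ-≤ (4 ^ m) (m≤m+n 16 4) ⟩
  4 ^ m * central 6      ≤⟨ 4^m*central[n]≤central[n+3m] m 6 (s≤s z≤n) ⟩
  central (6 + 3 * m)    ≡⟨ cong central (6+3m≡3[2+m] m) ⟩
  central (3 * suc (suc m)) ∎
  where
  open ≤-Reasoning
  6+3m≡3[2+m] : ∀ m → 6 + 3 * m ≡ 3 * suc (suc m)
  6+3m≡3[2+m] = solve-∀

summand≤central*C : ∀ t k j → summand t k j ≤ central (2 * t + 1 ∸ 3 * k) * ((2 * k) C (1 + 2 * j))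
summand≤central*C t k j =
  *-monoˡ-≤ ((2 * k) C (1 + 2 * j)) (binomℤ≤central (2 * t + 1 ∸ 3 * k) ((pos t -ℤ pos 1) -ℤ pos (3 * j)))

2n≢3 : ∀ n → 2 * n ≢ 3
2n≢3 n 2n≡3 = contradiction (subst (λ m → 2 * m ≡ 3) n≡1 2n≡3) λ ()
  where
  n≡1 : n ≡ 1
  n≡1 = trans (n≡⌊n+n/2⌋ n) (cong ⌊_/2⌋ (trans (cong (n +_) (sym (+-identityʳ n))) 2n≡3))

[2[1+t]+1∸3[1+k]]+3k≡2t : ∀ t k → 3 * suc k ≤ 2 * suc t + 1 →
                          (2 * suc t + 1 ∸ 3 * suc k) + 3 * k ≡ 2 * t
[2[1+t]+1∸3[1+k]]+3k≡2t t k h = begin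
  (2 * suc t + 1 ∸ 3 * suc k) + 3 * k
    ≡⟨ cong₂ (λ a b → (a ∸ b) + 3 * k) (2[1+t]+1≡3+2t t) (3[1+k]≡3+3k k) ⟩
  (2 * t ∸ 3 * k) + 3 * k
    ≡⟨ m∸n+n≡m 3k≤2t ⟩
  2 * t ∎
  where
  open ≡-Reasoning
  2[1+t]+1≡3+2t : ∀ t → 2 * suc t + 1 ≡ 3 + 2 * t
  2[1+t]+1≡3+2t = solve-∀
  3[1+k]≡3+3k : ∀ k → 3 * suc k ≡ 3 + 3 * k
  3[1+k]≡3+3k = solve-∀
  3k≤2t : 3 * k ≤ 2 * t
  3k≤2t = +-cancelˡ-≤ 3 (3 * k) (2 * t) (subst₂ _≤_ (3[1+k]≡3+3k k) (2[1+t]+1≡3+2t t) h)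

lemma5 : (t k : ℕ) → 1 ≤ k → 3 * k ≤ 2 * t + 1 →
    sumTo k (summand t k) ≤ 2 * ((2 * t ∸ 2) C (t ∸ 1))
lemma5 t       zero    () _
lemma5 zero    (suc k) _  3[1+k]≤1 =
  contradiction (≤-trans (*-monoʳ-≤ 3 (s≤s z≤n)) 3[1+k]≤1) λ { (s≤s ()) }
lemma5 (suc t) (suc k) _  3[1+k]≤2[1+t]+1 = begin
  sumTo (suc k) (summand (suc t) (suc k))
    ≤⟨ sumTo-*-≤ (suc k) (central n) (summand≤central*C (suc t) (suc k)) ⟩
  central n * sumTo (suc k) (λ j → (2 * suc k) C (1 + 2 * j))
    ≡⟨ cong (central n *_) (sumTo-[2+2k]C[1+2j]≡2*4^k k) ⟩
  central n * (2 * 4 ^ k)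
    ≡⟨ trans (*-comm (central n) (2 * 4 ^ k)) (*-assoc 2 (4 ^ k) (central n)) ⟩
  2 * (4 ^ k * central n)
    ≤⟨ *-monoʳ-≤ 2 (4^m*central[n]≤central[n+3m]′ k n (subst (_≢ 3) (sym n+3k≡2t) (2n≢3 t))) ⟩
  2 * central (n + 3 * k)
    ≡⟨ cong (λ m → 2 * central m) n+3k≡2t ⟩
  2 * central (2 * t)
    ≡⟨ cong (2 *_) (central[2n]≡[2n]Cn t) ⟩
  2 * ((2 * t) C t)
    ≡⟨ cong (λ m → 2 * (m C t)) (cong (_∸ 2) (2*[1+k]≡2+2*k t)) ⟨
  2 * ((2 * suc t ∸ 2) C (suc t ∸ 1)) ∎
  where
  open ≤-Reasoning
  n = 2 * suc t + 1 ∸ 3 * suc k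
  n+3k≡2t : n + 3 * k ≡ 2 * t
  n+3k≡2t = [2[1+t]+1∸3[1+k]]+3k≡2t t k 3[1+k]≤2[1+t]+1
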